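{- Let $\mathcal{G}$ and $\mathcal{H}$ be two hypergraphs, and let $\sigma=\langle\mathrm{In},\mathrm{Ex}\rangle$ be a precursor of a new minimal transversal $T$ of $\mathcal{G}$ with respect to $\mathcal{H}$. Then every vertex $v\in T\setminus\mathrm{In}$ is free in $\sigma$, and for each such vertex there exists an edge $G_v\in\mathrm{Sep}(\sigma)$ with $v\in G_v$ such that $\sigma+\langle\{v\},G_v\setminus\{v\}\rangle$ is coherent with $T$.
   Context: Hypergraphs are identified with their edge sets over the common vertex set $V$. A transversal of $\mathcal{G}$ meets every edge; it is minimal if no proper subset is a transversal; an independent set of $\mathcal{H}$ contains no edge of $\mathcal{H}$; a new transversal of $\mathcal{G}$ w.r.t. $\mathcal{H}$ is a transversal of $\mathcal{G}$ that is an independent set of $\mathcal{H}$ (a "new minimal transversal" is one that is a minimal transversal of $\mathcal{G}$). An assignment is a pair $\langle\mathrm{In},\mathrm{Ex}\rangle$ of disjoint subsets of $V$; $v$ is free if $v\notin\mathrm{In}\cup\mathrm{Ex}$; $\sigma+\langle A,B\rangle=\langle\mathrm{In}\cup A,\mathrm{Ex}\cup B\rangle$. $\sigma$ is coherent with a set $S$ if $\mathrm{In}\subseteq S$ and $\mathrm{Ex}\cap S=\emptyset$. $\mathrm{Sep}(\sigma)=\{G\in\mathcal{G}:G\cap\mathrm{In}=\emptyset\}$. $\sigma$ is a witness if $\mathrm{In}$ is a new transversal of $\mathcal{G}$ w.r.t. $\mathcal{H}$ or $\mathrm{Ex}$ is a new transversal of $\mathcal{H}$ w.r.t. $\mathcal{G}$.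 $\sigma$ is a precursor of a new transversal $T$ if $\sigma$ is coherent with $T$ and $\sigma$ is not a witness. -}

module Defs where

open import Data.Nat using (ℕ)
open import Data.Fin using (Fin)
open import Data.Fin.Subset using (Subset; _∈_; _∉_; _⊆_; _⊂_; _∪_; _∩_; _─_; ⁅_⁆; ⊥; Empty)
open import Data.List using (List)
open import Data.List.Membership.Propositional using () renaming (_∈_ to _∈ₗ_)
open import Data.Product using (_×_; ∃-syntax; _,_)
open import Data.Sum using (_⊎_)
open import Relation.Nullary using (¬_)
open import Relation.Binary.PropositionalEquality using (_≡_)

Hypergraph : ℕ → Set
Hypergraph n = List (Subset n)

Meets : ∀ {n} → Subset n → Subset n → Set
Meets E T = ∃[ v ] (v ∈ E × v ∈ T)

IsTransversal : ∀ {n} → Hypergraph n → Subset n → Set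
IsTransversal 𝒢 T = ∀ {E} → E ∈ₗ 𝒢 → Meets E T

IsMinimalTransversal : ∀ {n} → Hypergraph n → Subset n → Set
IsMinimalTransversal 𝒢 T = IsTransversal 𝒢 T × (∀ S → S ⊂ T → ¬ IsTransversal 𝒢 S)

IsIndependent : ∀ {n} → Hypergraph n → Subset n → Set
IsIndependent ℋ S = ∀ {E} → E ∈ₗ ℋ → ¬ (E ⊆ S)

IsNewTransversal : ∀ {n} → Hypergraph n → Hypergraph n → Subset n → Set
IsNewTransversal 𝒢 ℋ T = IsTransversal 𝒢 T × IsIndependent ℋ T

IsNewMinimalTransversal : ∀ {n} → Hypergraph n → Hypergraph n → Subset n → Set
IsNewMinimalTransversal 𝒢 ℋ T = IsMinimalTransversal 𝒢 T × IsIndependent ℋ T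

record Assignment (n : ℕ) : Set where
  constructor ⟨_,_⟩[_]
  field
    In       : Subset n
    Ex       : Subset n
    disjoint : Empty (In ∩ Ex)
open Assignment public

IsFree : ∀ {n} → Assignment n → Fin n → Set
IsFree σ v = v ∉ In σ × v ∉ Ex σ

_+⟨_,_⟩ : ∀ {n} → Assignment n → Subset n → Subset n → Subset n × Subset n
σ +⟨ A , B ⟩ = (In σ ∪ A , Ex σ ∪ B)

CoherentPair : ∀ {n} → Subset n × Subset n → Subset n → Set
CoherentPair (I , X) S = I ⊆ S × Empty (X ∩ S)

IsCoherent : ∀ {n} → Assignment n → Subset n → Set
IsCoherent σ S = CoherentPair (In σ , Ex σ) S

InSep : ∀ {n} → Hypergraph n → Assignment n → Subset n → Set
InSep 𝒢 σ G = G ∈ₗ 𝒢 × Empty (G ∩ In σ)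

IsWitness : ∀ {n} → Hypergraph n → Hypergraph n → Assignment n → Set
IsWitness 𝒢 ℋ σ = IsNewTransversal 𝒢 ℋ (In σ) ⊎ IsNewTransversal ℋ 𝒢 (Ex σ)

IsPrecursor : ∀ {n} → Hypergraph n → Hypergraph n → Assignment n → Subset n → Set
IsPrecursor 𝒢 ℋ σ T = IsCoherent σ T × ¬ IsWitness 𝒢 ℋ σ

-- Minimality of T gives, for each v ∈ T, a private edge G ∈ 𝒢 with G ∩ T = {v}:
-- otherwise T - v would still be a transversal. As In ⊆ T and v ∉ In, G misses
-- In, so G ∈ Sep(σ); and moving v into In and G - v into Ex stays coherent with
-- T precisely because T meets G only in v.
module Submission where

open import Defs
open import Data.Nat using (ℕ)
open import Data.Fin using (Fin)
open import Data.Fin.Properties using (_≟_; any?)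
open import Data.Fin.Subset using (Subset; _∈_; _∉_; _⊆_; _─_; _-_; _∪_; _∩_; ⁅_⁆; Empty; inside; outside)
open import Data.Fin.Subset.Properties
  using (_∈?_; x∈⁅y⁆⇒x≡y; x∉⁅y⁆⇒x≢y; x∈p∩q⁺; x∈p∩q⁻; x∈p∪q⁻; x∈p∧x≢y⇒x∈p-y; x∈p⇒p-x⊂p; p─q⊆p)
open import Data.List.Membership.Propositional using (find) renaming (_∈_ to _∈ₗ_)
open import Data.List.Relation.Unary.All using (lookup)
open import Data.List.Relation.Unary.All.Properties using (¬All⇒Any¬)
open import Data.Product using (_×_; ∃-syntax; _,_; proj₁)
open import Data.Sum using (inj₁; inj₂)
open import Data.Vec using (_∷_; there)
open import Function using (_∘_)
open import Relation.Nullary using (¬_; Dec; yes; no; contradiction)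
open import Relation.Nullary.Decidable using (_×-dec_)
open import Relation.Binary.PropositionalEquality using (_≡_; _≢_; sym; subst)

private
  variable
    n : ℕ
    u v : Fin n
    p S T I X A B G : Subset n
    𝒢 : Hypergraph n
    σ : Assignment n

x∈p─q⇒x∉q : ∀ (p q : Subset n) → u ∈ p ─ q → u ∉ q
x∈p─q⇒x∉q (_ ∷ p) (inside  ∷ q) (there u∈p─q) (there u∈q) = x∈p─q⇒x∉q p q u∈p─q u∈q
x∈p─q⇒x∉q (_ ∷ p) (outside ∷ q) (there u∈p─q) (there u∈q) = x∈p─q⇒x∉q p q u∈p─q u∈q

x∈p-y⇒x≢y : ∀ (p : Subset n) → u ∈ p - v → u ≢ v
x∈p-y⇒x≢y {v = v} p = x∉⁅y⁆⇒x≢y ∘ x∈p─q⇒x∉q p ⁅ v ⁆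

x∈p⇒⁅x⁆⊆p : v ∈ p → ⁅ v ⁆ ⊆ p
x∈p⇒⁅x⁆⊆p {v = v} {p = p} v∈p u∈⁅v⁆ = subst (_∈ p) (sym (x∈⁅y⁆⇒x≡y v u∈⁅v⁆)) v∈p

meets? : (E S : Subset n) → Dec (Meets E S)
meets? E S = any? (λ u → (u ∈? E) ×-dec (u ∈? S))

¬transversal⇒missedEdge : ¬ IsTransversal 𝒢 S → ∃[ E ] (E ∈ₗ 𝒢 × ¬ Meets E S)
¬transversal⇒missedEdge {𝒢 = 𝒢} {S = S} ¬tr =
  find (¬All⇒Any¬ (λ E → meets? E S) 𝒢 (λ all → ¬tr (lookup all)))

PrivateEdge : Hypergraph n → Subset n → Fin n → Subset n → Set
PrivateEdge 𝒢 T v G = G ∈ₗ 𝒢 × v ∈ G × (∀ {u} → u ∈ G → u ∈ T → u ≡ v)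

minimalTransversal⇒privateEdge : IsMinimalTransversal 𝒢 T → v ∈ T → ∃[ G ] PrivateEdge 𝒢 T v G
minimalTransversal⇒privateEdge {T = T} {v = v} (transversal , minimal) v∈T
  with ¬transversal⇒missedEdge (minimal (T - v) (x∈p⇒p-x⊂p v∈T))
... | G , G∈𝒢 , G∩[T-v]≡∅ = G , G∈𝒢 , v∈G , only-v
  where
  only-v : ∀ {u} → u ∈ G → u ∈ T → u ≡ v
  only-v {u} u∈G u∈T with u ≟ v
  ... | yes u≡v = u≡v
  ... | no  u≢v = contradiction (u , u∈G , x∈p∧x≢y⇒x∈p-y u∈T u≢v) G∩[T-v]≡∅

  v∈G : v ∈ G
  v∈G with transversal G∈𝒢
  ... | w , w∈G , w∈T = subst (_∈ G) (only-v w∈G w∈T) w∈G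

privateEdge⇒inSep : In σ ⊆ T → v ∉ In σ → PrivateEdge 𝒢 T v G → InSep 𝒢 σ G
privateEdge⇒inSep {σ = σ} {G = G} In⊆T v∉In (G∈𝒢 , _ , only-v) = G∈𝒢 , G∩In≡∅
  where
  G∩In≡∅ : Empty (G ∩ In σ)
  G∩In≡∅ (u , u∈G∩In) with x∈p∩q⁻ G (In σ) u∈G∩In
  ... | u∈G , u∈In = v∉In (subst (_∈ In σ) (only-v u∈G (In⊆T u∈In)) u∈In)

privateEdge⇒[G-v]∩T≡∅ : PrivateEdge 𝒢 T v G → Empty ((G - v) ∩ T)
privateEdge⇒[G-v]∩T≡∅ {T = T} {v = v} {G = G} (_ , _ , only-v) (u , u∈[G-v]∩T)
  with x∈p∩q⁻ (G - v) T u∈[G-v]∩T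
... | u∈G-v , u∈T = x∈p-y⇒x≢y G u∈G-v (only-v (p─q⊆p G ⁅ v ⁆ u∈G-v) u∈T)

coherentPair-∪ : CoherentPair (I , X) S → A ⊆ S → Empty (B ∩ S) → CoherentPair (I ∪ A , X ∪ B) S
coherentPair-∪ {I = I} {X = X} {S = S} {A = A} {B = B} (I⊆S , X∩S≡∅) A⊆S B∩S≡∅ = I∪A⊆S , [X∪B]∩S≡∅
  where
  I∪A⊆S : I ∪ A ⊆ S
  I∪A⊆S u∈I∪A with x∈p∪q⁻ I A u∈I∪A
  ... | inj₁ u∈I = I⊆S u∈I
  ... | inj₂ u∈A = A⊆S u∈A

  [X∪B]∩S≡∅ : Empty ((X ∪ B) ∩ S)
  [X∪B]∩S≡∅ (u , u∈[X∪B]∩S) with x∈p∩q⁻ (X ∪ B) S u∈[X∪B]∩S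
  ... | u∈X∪B , u∈S with x∈p∪q⁻ X B u∈X∪B
  ...   | inj₁ u∈X = X∩S≡∅ (u , x∈p∩q⁺ (u∈X , u∈S))
  ...   | inj₂ u∈B = B∩S≡∅ (u , x∈p∩q⁺ (u∈B , u∈S))

coherent∧∈⇒free : IsCoherent σ T → v ∈ T → v ∉ In σ → IsFree σ v
coherent∧∈⇒free (_ , Ex∩T≡∅) v∈T v∉In = v∉In , λ v∈Ex → Ex∩T≡∅ (_ , x∈p∩q⁺ (v∈Ex , v∈T))

lemma8 : ∀ {n} (𝒢 ℋ : Hypergraph n) (σ : Assignment n) (T : Subset n) →
         IsNewMinimalTransversal 𝒢 ℋ T →
         IsPrecursor 𝒢 ℋ σ T →
         ∀ v → v ∈ T → v ∉ In σ →
         IsFree σ v ×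
         (∃[ G ] (InSep 𝒢 σ G × v ∈ G × CoherentPair (σ +⟨ ⁅ v ⁆ , G ─ ⁅ v ⁆ ⟩) T))
lemma8 𝒢 ℋ σ T (minimal , _) (coherent , _) v v∈T v∉In
  with minimalTransversal⇒privateEdge minimal v∈T
... | G , G-private@(_ , v∈G , _) =
  coherent∧∈⇒free {σ = σ} coherent v∈T v∉In ,
  G , privateEdge⇒inSep {σ = σ} (proj₁ coherent) v∉In G-private , v∈G ,
  coherentPair-∪ coherent (x∈p⇒⁅x⁆⊆p v∈T) (privateEdge⇒[G-v]∩T≡∅ G-private)
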